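{- Let $G$ be a chordal graph and let $\mathcal{H}'=(V',\mathcal{E}')$ be a Berge-acyclic subhypergraph of $\mathcal{H}(G)$. If $F_1,\dots,F_k$ are the connected components of $G[\mathcal{E}']$, then each $F_i$ is a cactus and every cycle of $F_i$ is a $3$-cycle, for each $1\le i\le k$.
   Context: All graphs are finite, simple and undirected. A graph is chordal if it has no induced cycle of length greater than $3$. A cactus is a connected graph in which every edge lies in at most one cycle. A hypergraph is a pair $(V,\mathcal{E})$ with $V$ finite and $\mathcal{E}$ a set of nonempty subsets of $V$; a subhypergraph of $(V,\mathcal{E})$ is a hypergraph $(V',\mathcal{E}')$ with $V'\subseteq V$, $\mathcal{E}'\subseteq\mathcal{E}$. A Berge-cycle is a sequence $(E_1,x_1,\dots,E_n,x_n)$ with $n\ge 2$ where the $E_i$ are distinct hyperedges, the $x_i$ are distinct vertices, and $x_i\in E_i\cap E_{i+1}$ for every $i$ (indices mod $n$); a hypergraph is Berge-acyclic if it has no Berge-cycle. For a graph $G=(V,E)$, $\mathcal{H}(G)=(V,\mathcal{E})$ is the hypergraph whose hyperedges are exactly the vertex sets of $3$-cycles (triangles) of $G$. For a set $\mathcal{E}'$ of hyperedges of $\mathcal{H}(G)$, $G[\mathcal{E}']$ is the graph whose vertices are those occurring in some hyperedge of $\mathcal{E}'$, and in which $u,v$ are adjacent iff $\{u,v\}\subseteq e$ for some $e\in\mathcal{E}'$. -}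

module Defs where

open import Level using (0ℓ)
open import Data.Nat using (ℕ; _≤_; _>_)
open import Data.Fin using (Fin)
open import Data.Fin.Subset using (Subset; _∈_; _⊆_; _∪_; ⁅_⁆)
open import Data.List using (List; []; _∷_; _++_; [_]; length; map)
open import Data.List.Relation.Unary.All using (All)
open import Data.List.Relation.Unary.Unique.Propositional using (Unique)
import Data.List.Membership.Propositional as LMem
open import Data.Product using (Σ; ∃; ∃-syntax; _×_; _,_; proj₁; proj₂)
open import Data.Sum using (_⊎_)
open import Data.Empty using (⊥)
open import Relation.Nullary using (¬_)
open import Relation.Binary.PropositionalEquality using (_≡_; _≢_)

record SimpleGraph (n : ℕ) : Set₁ where
  field
    Adj     : Fin n → Fin n → Set
    sym     : ∀ {u v} → Adj u v → Adj v u
    irrefl  : ∀ {u} → ¬ Adj u u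
open SimpleGraph public

record SubGraph (n : ℕ) : Set₁ where
  field
    V : Fin n → Set
    E : Fin n → Fin n → Set
open SubGraph public

whole : ∀ {n} → SimpleGraph n → SubGraph n
whole G = record { V = λ _ → Data.Unit.⊤ ; E = Adj G }
  where import Data.Unit

Chain : {A : Set} → (A → A → Set) → List A → Set
Chain R []            = Data.Unit.⊤ where import Data.Unit
Chain R (a ∷ [])      = Data.Unit.⊤ where import Data.Unit
Chain R (a ∷ b ∷ as)  = R a b × Chain R (b ∷ as)

ConsecIn : {A : Set} → List A → A → A → Set
ConsecIn []           a b = ⊥
ConsecIn (x ∷ [])     a b = ⊥
ConsecIn (x ∷ y ∷ xs) a b = (x ≡ a × y ≡ b) ⊎ ConsecIn (y ∷ xs) a b

close : {A : Set} → A → List A → List A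
close x xs = x ∷ xs ++ [ x ]

record Cycle {n : ℕ} (H : SubGraph n) : Set where
  constructor mkCycle
  field
    start    : Fin n
    rest     : List (Fin n)
    inV      : All (V H) (start ∷ rest)
    distinct : Unique (start ∷ rest)
    long     : 3 ≤ length (start ∷ rest)
    adjacent : Chain (E H) (close start rest)
open Cycle public

cycleLength : ∀ {n} {H : SubGraph n} → Cycle H → ℕ
cycleLength C = length (start C ∷ rest C)

EdgeOf : ∀ {n} {H : SubGraph n} → Cycle H → Fin n → Fin n → Set
EdgeOf C a b = ConsecIn (close (start C) (rest C)) a b
             ⊎ ConsecIn (close (start C) (rest C)) b a

VertexOf : ∀ {n} {H : SubGraph n} → Cycle H → Fin n → Set
VertexOf C v = v LMem.∈ (start C ∷ rest C)

-- two cycles are the same cycle (subgraph) iff they have the same edges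
SameCycle : ∀ {n} {H : SubGraph n} → Cycle H → Cycle H → Set
SameCycle C D = ∀ a b → (EdgeOf C a b → EdgeOf D a b) × (EdgeOf D a b → EdgeOf C a b)

Induced : ∀ {n} {H : SubGraph n} → Cycle H → Set
Induced {H = H} C = ∀ u v → VertexOf C u → VertexOf C v → E H u v → EdgeOf C u v

Chordal : ∀ {n} → SimpleGraph n → Set
Chordal G = (C : Cycle (whole G)) → Induced C → ¬ (cycleLength C > 3)

data Walk {n : ℕ} (R : Fin n → Fin n → Set) : Fin n → Fin n → Set where
  here : ∀ {x} → Walk R x x
  step : ∀ {x y z} → R x y → Walk R y z → Walk R x z

Connected : ∀ {n} → SubGraph n → Set
Connected H = (∃[ v ] V H v) × (∀ u v → V H u → V H v → Walk (E H) u v)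

IsCactus : ∀ {n} → SubGraph n → Set
IsCactus H = Connected H
  × (∀ u v → E H u v → (C D : Cycle H) → EdgeOf C u v → EdgeOf D u v → SameCycle C D)

AllCyclesTriangles : ∀ {n} → SubGraph n → Set
AllCyclesTriangles H = (C : Cycle H) → cycleLength C ≡ 3

IsTriangle : ∀ {n} → SimpleGraph n → Subset n → Set
IsTriangle G e = ∃[ a ] ∃[ b ] ∃[ c ]
  (Adj G a b × Adj G b c × Adj G a c × e ≡ ⁅ a ⁆ ∪ ⁅ b ⁆ ∪ ⁅ c ⁆)

-- (V' , E') is a subhypergraph of H(G): V' ⊆ V (automatic), every
-- hyperedge of E' is a hyperedge of H(G), and (V' , E') is a
-- hypergraph (its hyperedges are subsets of V').
IsSubHypergraphOfH : ∀ {n} → SimpleGraph n → Subset n → List (Subset n) → Set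
IsSubHypergraphOfH G V' E' = All (λ e → IsTriangle G e × e ⊆ V') E'

-- A Berge-cycle (E₁,x₁,…,Eₘ,xₘ), m ≥ 2, given as the list of pairs
-- (Eᵢ , xᵢ): distinct hyperedges of E', distinct vertices,
-- xᵢ ∈ Eᵢ and xᵢ ∈ Eᵢ₊₁ (indices mod m).
record BergeCycle {n : ℕ} (E' : List (Subset n)) : Set where
  field
    first      : Subset n × Fin n
    others     : List (Subset n × Fin n)
    twoOrMore  : 2 ≤ length (first ∷ others)
    edgesIn    : All (λ p → proj₁ p LMem.∈ E') (first ∷ others)
    edgesDist  : Unique (map proj₁ (first ∷ others))
    vertsDist  : Unique (map proj₂ (first ∷ others))
    inOwn      : All (λ p → proj₂ p ∈ proj₁ p) (first ∷ others)
    inNext     : Chain (λ p q → proj₂ p ∈ proj₁ q) (close first others)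

BergeAcyclic : ∀ {n} → List (Subset n) → Set
BergeAcyclic E' = ¬ BergeCycle E'

inducedBy : ∀ {n} → List (Subset n) → SubGraph n
inducedBy E' = record
  { V = λ v → ∃[ e ] (e LMem.∈ E' × v ∈ e)
  ; E = λ u v → u ≢ v × ∃[ e ] (e LMem.∈ E' × u ∈ e × v ∈ e)
  }

componentOf : ∀ {n} → SubGraph n → Fin n → SubGraph n
componentOf H x = record
  { V = λ v → V H x × Walk (E H) x v
  ; E = λ u v → (V H x × Walk (E H) x u) × (V H x × Walk (E H) x v) × E H u v
  }

-- Label each edge xᵢxᵢ₊₁ of a cycle x₁…xₘ of G[E'] by a
-- hyperedge Eᵢ ∈ E' containing it; then (E₁,x₂,E₂,x₃,…,Eₘ,x₁) is a closed Berge walk.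
-- In a Berge-acyclic hypergraph such a walk uses a single hyperedge: without repeated
-- hyperedges it is a Berge cycle, and a repeated hyperedge cuts it into two shorter
-- closed walks through that hyperedge.  Hence every cycle lies in one triangle of G, so
-- it is that triangle.  Two cycles through an edge uv lie in hyperedges E, F both
-- containing u and v, and E = F since otherwise (E,u,F,v) is a Berge cycle.

module Submission where

open import Defs hiding (sym)
open import Data.Nat using (ℕ; suc; _≤_; _<_; z≤n; s≤s)
open import Data.Nat.Properties using (≤-trans; ≤-reflexive; ≤-antisym; ≤⇒≯; <-≤-trans)
open import Data.Nat.Induction using (<-wellFounded)
open import Induction.WellFounded using (Acc; acc)
open import Data.Fin using (Fin)
import Data.Fin.Properties as Fin
open import Data.Fin.Subset using (Subset; _∈_; _∪_; ⁅_⁆)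
open import Data.Fin.Subset.Properties using (x∈p∪q⁻; x∈⁅y⁆⇒x≡y)
open import Data.Vec.Properties using (≡-dec)
import Data.Bool as Bool
open import Data.List using (List; []; _∷_; _++_; [_]; length; map; initLast; _∷ʳ′_)
open import Data.List.Properties
  using (++-identityʳ; ++-assoc; ++-conicalʳ; map-++; ∷ʳ-injective; length-++-≤ˡ; length-++-≤ʳ; length-++-sucʳ)
open import Data.List.Relation.Unary.All as All using (All; []; _∷_)
import Data.List.Relation.Unary.All.Properties as All
open import Data.List.Relation.Unary.AllPairs using (AllPairs; []; _∷_)
open import Data.List.Relation.Unary.Any using (here; there; any?)
open import Data.List.Relation.Unary.Unique.Propositional using (Unique)
open import Data.List.Membership.Propositional using (find) renaming (_∈_ to _∈ₗ_)
open import Data.List.Membership.Propositional.Properties using (∈-∃++; ∈-++⁻)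
import Data.List.Membership.DecPropositional as DecMembership
open import Data.List.Relation.Binary.Subset.Propositional using (_⊆_)
open import Data.List.Relation.Binary.Permutation.Propositional using (_↭_; ↭⇒↭ₛ)
open import Data.List.Relation.Binary.Permutation.Propositional.Properties
  using (++-comm; shift; All-resp-↭; ∈-resp-↭; ↭-length; map⁺)
import Data.List.Relation.Binary.Permutation.Setoid.Properties as PermutationSetoid
open import Data.Product using (∃-syntax; _×_; _,_; proj₁; proj₂)
import Data.Product as Product
open import Data.Sum using (_⊎_; inj₁; inj₂)
open import Data.Unit using (⊤; tt)
open import Data.Empty using (⊥-elim)
open import Function.Bundles using (_⇔_; mk⇔; Equivalence)
open import Relation.Nullary using (yes; no; contradiction)
open import Relation.Binary.Definitions using (DecidableEquality)
open import Relation.Binary.PropositionalEquality using (_≡_; _≢_; refl; sym; trans; subst; cong; setoid)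

Chain-map : {A : Set} {R S : A → A → Set} → (∀ {a b} → R a b → S a b) → ∀ xs → Chain R xs → Chain S xs
Chain-map f []           _       = tt
Chain-map f (x ∷ [])     _       = tt
Chain-map f (x ∷ y ∷ xs) (r , c) = f r , Chain-map f (y ∷ xs) c

Cyclic : {A : Set} → (A → A → Set) → List A → Set
Cyclic R []       = ⊤
Cyclic R (x ∷ xs) = Chain R (close x xs)

module _ {A : Set} {R : A → A → Set} where

  Chain-++⁻ : ∀ xs {y} ys → Chain R (xs ++ y ∷ ys) → Chain R (xs ++ [ y ]) × Chain R (y ∷ ys)
  Chain-++⁻ []            ys c       = tt , c
  Chain-++⁻ (x ∷ [])      ys (r , c) = (r , tt) , c
  Chain-++⁻ (x ∷ x′ ∷ xs) ys (r , c) = Product.map₁ (r ,_) (Chain-++⁻ (x′ ∷ xs) ys c)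

  Chain-++⁺ : ∀ xs {y} ys → Chain R (xs ++ [ y ]) → Chain R (y ∷ ys) → Chain R (xs ++ y ∷ ys)
  Chain-++⁺ []            ys _        c  = c
  Chain-++⁺ (x ∷ [])      ys (r , _)  c  = r , c
  Chain-++⁺ (x ∷ x′ ∷ xs) ys (r , c₁) c₂ = r , Chain-++⁺ (x′ ∷ xs) ys c₁ c₂

  Chain-∷ʳ-resp : ∀ {y y′} → (∀ {z} → R z y → R z y′) → ∀ xs → Chain R (xs ++ [ y ]) → Chain R (xs ++ [ y′ ])
  Chain-∷ʳ-resp f []            _       = tt
  Chain-∷ʳ-resp f (x ∷ [])      (r , _) = f r , tt
  Chain-∷ʳ-resp f (x ∷ x′ ∷ xs) (r , c) = r , Chain-∷ʳ-resp f (x′ ∷ xs) c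

  Cyclic-rotate : ∀ xs ys → Cyclic R (xs ++ ys) → Cyclic R (ys ++ xs)
  Cyclic-rotate [] ys c rewrite ++-identityʳ ys = c
  Cyclic-rotate (x ∷ xs) [] c rewrite ++-identityʳ xs = c
  Cyclic-rotate (x ∷ xs) (y ∷ ys) c
    rewrite ++-assoc xs (y ∷ ys) [ x ] | ++-assoc ys (x ∷ xs) [ y ] =
    Chain-++⁺ (y ∷ ys) (xs ++ [ y ]) c₂ c₁
    where
    c₁ : Chain R (x ∷ xs ++ [ y ])
    c₁ = proj₁ (Chain-++⁻ (x ∷ xs) (ys ++ [ x ]) c)
    c₂ : Chain R (y ∷ ys ++ [ x ])
    c₂ = proj₂ (Chain-++⁻ (x ∷ xs) (ys ++ [ x ]) c)

  Cyclic-split : ∀ {x y} → (∀ {z} → R z y → R z x) → (∀ {z} → R z x → R z y) →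
                 ∀ xs ys → Cyclic R (x ∷ xs ++ y ∷ ys) → Cyclic R (x ∷ xs) × Cyclic R (y ∷ ys)
  Cyclic-split {x} {y} y⇒x x⇒y xs ys c rewrite ++-assoc xs (y ∷ ys) [ x ] =
    Product.map (Chain-∷ʳ-resp y⇒x (x ∷ xs)) (Chain-∷ʳ-resp x⇒y (y ∷ ys))
                (Chain-++⁻ (x ∷ xs) (ys ++ [ x ]) c)

AllPairs-++⁻ : {A : Set} {R : A → A → Set} → ∀ xs {ys} → AllPairs R (xs ++ ys) → AllPairs R xs × AllPairs R ys
AllPairs-++⁻ []       u        = [] , u
AllPairs-++⁻ (x ∷ xs) (px ∷ u) = Product.map₁ (All.++⁻ˡ xs px ∷_) (AllPairs-++⁻ xs u)

module _ {A : Set} where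

  ∈-++-∷⁻ : ∀ {z x : A} ys₁ ys₂ → z ∈ₗ ys₁ ++ x ∷ ys₂ → z ≢ x → z ∈ₗ ys₁ ++ ys₂
  ∈-++-∷⁻ {x = x} ys₁ ys₂ z∈ z≢x with ∈-resp-↭ (shift x ys₁ ys₂) z∈
  ... | here z≡x  = contradiction z≡x z≢x
  ... | there z∈′ = z∈′

  Unique-⊆⇒length≤ : ∀ {xs ys : List A} → Unique xs → xs ⊆ ys → length xs ≤ length ys
  Unique-⊆⇒length≤ {[]}     _            _     = z≤n
  Unique-⊆⇒length≤ {x ∷ xs} (x≢xs ∷ u) xs⊆ys with ∈-∃++ (xs⊆ys (here refl))
  ... | ys₁ , ys₂ , refl =
    ≤-trans (s≤s (Unique-⊆⇒length≤ u xs⊆ys₁ys₂)) (≤-reflexive (sym (↭-length (shift x ys₁ ys₂))))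
    where
    xs⊆ys₁ys₂ : xs ⊆ ys₁ ++ ys₂
    xs⊆ys₁ys₂ z∈ = ∈-++-∷⁻ ys₁ ys₂ (xs⊆ys (there z∈)) (λ z≡x → All.lookup x≢xs z∈ (sym z≡x))

  module _ (_≟_ : DecidableEquality A) where
    open DecMembership _≟_ using (_∈?_)

    Unique-⊆-length⇒⊇ : ∀ {xs ys : List A} → Unique xs → xs ⊆ ys → length ys ≤ length xs → ys ⊆ xs
    Unique-⊆-length⇒⊇ {xs} {ys} u xs⊆ys ys≤xs {z} z∈ys with z ∈? xs
    ... | yes z∈xs = z∈xs
    ... | no  z∉xs = contradiction longer (≤⇒≯ ys≤xs)
      where
      z∷xs⊆ys : z ∷ xs ⊆ ys
      z∷xs⊆ys (here refl) = z∈ys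
      z∷xs⊆ys (there w∈)  = xs⊆ys w∈
      longer : length xs < length ys
      longer = Unique-⊆⇒length≤ (All.tabulate (λ w∈ z≡w → z∉xs (subst (_∈ₗ xs) (sym z≡w) w∈)) ∷ u) z∷xs⊆ys

data HasRepeat {A B : Set} (f : A → B) : List A → Set where
  repeat : ∀ pre x mid y post → f x ≡ f y → HasRepeat f (pre ++ x ∷ mid ++ y ∷ post)

module _ {A B : Set} (f : A → B) (_≟_ : DecidableEquality B) where

  unique⊎hasRepeat : ∀ xs → Unique (map f xs) ⊎ HasRepeat f xs
  unique⊎hasRepeat []       = inj₁ []
  unique⊎hasRepeat (x ∷ xs) with any? (λ y → f x ≟ f y) xs
  ... | yes fx∈xs with find fx∈xs
  ...   | y , y∈xs , fx≡fy with ∈-∃++ y∈xs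
  ...     | mid , post , refl = inj₂ (repeat [] x mid y post fx≡fy)
  unique⊎hasRepeat (x ∷ xs) | no fx∉xs with unique⊎hasRepeat xs
  ... | inj₁ u = inj₁ (All.map⁺ (All.¬Any⇒All¬ xs fx∉xs) ∷ u)
  ... | inj₂ (repeat pre y mid z post fy≡fz) = inj₂ (repeat (x ∷ pre) y mid z post fy≡fz)

length-<-++ : {A : Set} (xs : List A) (y : A) (ys : List A) → length xs < length (xs ++ y ∷ ys)
length-<-++ xs y ys = <-≤-trans (s≤s (length-++-≤ˡ xs)) (≤-reflexive (sym (length-++-sucʳ xs y ys)))

module _ {n : ℕ} {R : Fin n → Fin n → Set} where

  _▷_ : ∀ {a b c} → Walk R a b → R b c → Walk R a c
  here     ▷ r = step r here
  step s w ▷ r = step s (w ▷ r)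

  _++ʷ_ : ∀ {a b c} → Walk R a b → Walk R b c → Walk R a c
  here     ++ʷ w′ = w′
  step r w ++ʷ w′ = step r (w ++ʷ w′)

  reverseʷ : (∀ {u v} → R u v → R v u) → ∀ {a b} → Walk R a b → Walk R b a
  reverseʷ R-sym here       = here
  reverseʷ R-sym (step r w) = reverseʷ R-sym w ▷ R-sym r

module _ {n : ℕ} (H : SubGraph n) {x : Fin n} (x∈H : V H x) where

  Walk-componentOf : ∀ {a b} → Walk (E H) x a → Walk (E H) a b → Walk (E (componentOf H x)) a b
  Walk-componentOf x⇝a here       = here
  Walk-componentOf x⇝a (step r w) = step ((x∈H , x⇝a) , (x∈H , x⇝a ▷ r) , r) (Walk-componentOf (x⇝a ▷ r) w)

  componentOf-connected : (∀ {u v} → E H u v → E H v u) → Connected (componentOf H x)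
  componentOf-connected E-sym =
    (x , x∈H , here) , λ { u v (_ , x⇝u) (_ , x⇝v) → Walk-componentOf x⇝u (reverseʷ E-sym x⇝u ++ʷ x⇝v) }

module _ {n : ℕ} {H : SubGraph n} where

  vertices : Cycle H → List (Fin n)
  vertices C = start C ∷ rest C

  EdgeOf⇔-triangle : (C : Cycle H) → cycleLength C ≡ 3 →
                     ∀ {u v} → EdgeOf C u v ⇔ (VertexOf C u × VertexOf C v × u ≢ v)
  EdgeOf⇔-triangle C@(mkCycle s (r₁ ∷ r₂ ∷ []) _ ((s≢r₁ ∷ s≢r₂ ∷ []) ∷ (r₁≢r₂ ∷ []) ∷ [] ∷ []) _ _) refl =
    mk⇔ edge⇒ edge⇐
    where
    ≢-sym : ∀ {a b : Fin n} → a ≢ b → b ≢ a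
    ≢-sym a≢b b≡a = a≢b (sym b≡a)
    edge⇒ : ∀ {u v} → EdgeOf C u v → VertexOf C u × VertexOf C v × u ≢ v
    edge⇒ (inj₁ (inj₁ (refl , refl)))               = here refl , there (here refl) , s≢r₁
    edge⇒ (inj₁ (inj₂ (inj₁ (refl , refl))))        = there (here refl) , there (there (here refl)) , r₁≢r₂
    edge⇒ (inj₁ (inj₂ (inj₂ (inj₁ (refl , refl))))) = there (there (here refl)) , here refl , ≢-sym s≢r₂
    edge⇒ (inj₂ (inj₁ (refl , refl)))               = there (here refl) , here refl , ≢-sym s≢r₁
    edge⇒ (inj₂ (inj₂ (inj₁ (refl , refl))))        = there (there (here refl)) , there (here refl) , ≢-sym r₁≢r₂
    edge⇒ (inj₂ (inj₂ (inj₂ (inj₁ (refl , refl))))) = here refl , there (there (here refl)) , s≢r₂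
    edge⇐ : ∀ {u v} → VertexOf C u × VertexOf C v × u ≢ v → EdgeOf C u v
    edge⇐ (here refl               , here refl               , u≢v) = ⊥-elim (u≢v refl)
    edge⇐ (here refl               , there (here refl)       , _)   = inj₁ (inj₁ (refl , refl))
    edge⇐ (here refl               , there (there (here refl)) , _) = inj₂ (inj₂ (inj₂ (inj₁ (refl , refl))))
    edge⇐ (there (here refl)       , here refl               , _)   = inj₂ (inj₁ (refl , refl))
    edge⇐ (there (here refl)       , there (here refl)       , u≢v) = ⊥-elim (u≢v refl)
    edge⇐ (there (here refl)       , there (there (here refl)) , _) = inj₁ (inj₂ (inj₁ (refl , refl)))
    edge⇐ (there (there (here refl)) , here refl             , _)   = inj₁ (inj₂ (inj₂ (inj₁ (refl , refl))))
    edge⇐ (there (there (here refl)) , there (here refl)     , _)   = inj₂ (inj₂ (inj₁ (refl , refl)))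
    edge⇐ (there (there (here refl)) , there (there (here refl)) , u≢v) = ⊥-elim (u≢v refl)

  module _ {ws : List (Fin n)} (|ws|≡3 : length ws ≡ 3) where

    cycleLength≡3 : (C : Cycle H) → vertices C ⊆ ws → cycleLength C ≡ 3
    cycleLength≡3 C C⊆ws = ≤-antisym (subst (cycleLength C ≤_) |ws|≡3 (Unique-⊆⇒length≤ (distinct C) C⊆ws)) (long C)

    cycle-⊇ : (C : Cycle H) → vertices C ⊆ ws → ws ⊆ vertices C
    cycle-⊇ C C⊆ws = Unique-⊆-length⇒⊇ Fin._≟_ (distinct C) C⊆ws
                       (≤-reflexive (trans |ws|≡3 (sym (cycleLength≡3 C C⊆ws))))

    SameCycle-⊆ : (C D : Cycle H) → vertices C ⊆ ws → vertices D ⊆ ws → SameCycle C D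
    SameCycle-⊆ C D C⊆ws D⊆ws a b = transfer C D C⊆ws D⊆ws , transfer D C D⊆ws C⊆ws
      where
      transfer : (C D : Cycle H) → vertices C ⊆ ws → vertices D ⊆ ws → EdgeOf C a b → EdgeOf D a b
      transfer C D C⊆ws D⊆ws ab∈C with Equivalence.to (EdgeOf⇔-triangle C (cycleLength≡3 C C⊆ws)) ab∈C
      ... | a∈C , b∈C , a≢b = Equivalence.from (EdgeOf⇔-triangle D (cycleLength≡3 D D⊆ws))
                                (C⊆D a∈C , C⊆D b∈C , a≢b)
        where
        C⊆D : vertices C ⊆ vertices D
        C⊆D v∈C = cycle-⊇ D D⊆ws (C⊆ws v∈C)
↭-cut : {A : Set} (pre : List A) (x : A) (mid : List A) (y : A) (post : List A) →
        pre ++ x ∷ mid ++ y ∷ post ↭ x ∷ mid ++ y ∷ post ++ pre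
↭-cut pre x mid y post =
  subst (pre ++ x ∷ mid ++ y ∷ post ↭_) (cong (x ∷_) (++-assoc mid (y ∷ post) pre)) (++-comm pre (x ∷ mid ++ y ∷ post))

module _ {n : ℕ} where

  Meets : Subset n × Fin n → Subset n × Fin n → Set
  Meets p q = proj₂ p ∈ proj₁ q

  Flag : List (Subset n) → Subset n × Fin n → Set
  Flag E' p = proj₁ p ∈ₗ E' × proj₂ p ∈ proj₁ p

  -- A Berge cycle (E₁,x₁,…,Eₘ,xₘ) in which hyperedges may repeat and m may be 0 or 1.
  record ClosedBergeWalk (E' : List (Subset n)) (ps : List (Subset n × Fin n)) : Set where
    field
      flags     : All (Flag E') ps
      vertsDist : Unique (map proj₂ ps)
      inNext    : Cyclic Meets ps

  SingleHyperedge : List (Subset n × Fin n) → Set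
  SingleHyperedge ps = ∀ {p q} → p ∈ₗ ps → q ∈ₗ ps → proj₁ p ≡ proj₁ q

  SingleHyperedge-resp-↭ : ∀ {ps qs} → ps ↭ qs → SingleHyperedge qs → SingleHyperedge ps
  SingleHyperedge-resp-↭ σ single p∈ q∈ = single (∈-resp-↭ σ p∈) (∈-resp-↭ σ q∈)

  SingleHyperedge-++ : ∀ {x y xs ys} → proj₁ x ≡ proj₁ y →
                       SingleHyperedge (x ∷ xs) → SingleHyperedge (y ∷ ys) → SingleHyperedge (x ∷ xs ++ y ∷ ys)
  SingleHyperedge-++ {x} {y} {xs} {ys} x≡y singleˣ singleʸ p∈ q∈ = trans (toX p∈) (sym (toX q∈))
    where
    toX : ∀ {r} → r ∈ₗ x ∷ xs ++ y ∷ ys → proj₁ r ≡ proj₁ x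
    toX r∈ with ∈-++⁻ (x ∷ xs) r∈
    ... | inj₁ r∈ˣ = singleˣ r∈ˣ (here refl)
    ... | inj₂ r∈ʸ = trans (singleʸ r∈ʸ (here refl)) (sym x≡y)

module _ {n : ℕ} {E' : List (Subset n)} where
  open ClosedBergeWalk

  ClosedBergeWalk-rotate : ∀ xs ys → ClosedBergeWalk E' (xs ++ ys) → ClosedBergeWalk E' (ys ++ xs)
  ClosedBergeWalk-rotate xs ys w = record
    { flags     = All-resp-↭ (++-comm xs ys) (flags w)
    ; vertsDist = PermutationSetoid.Unique-resp-↭ (setoid (Fin n)) (↭⇒↭ₛ (map⁺ proj₂ (++-comm xs ys))) (vertsDist w)
    ; inNext    = Cyclic-rotate xs ys (inNext w)
    }

  ClosedBergeWalk-split : ∀ {x y} → proj₁ x ≡ proj₁ y → ∀ xs ys → ClosedBergeWalk E' (x ∷ xs ++ y ∷ ys) →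
                          ClosedBergeWalk E' (x ∷ xs) × ClosedBergeWalk E' (y ∷ ys)
  ClosedBergeWalk-split {x} {y} x≡y xs ys w =
    record { flags = proj₁ flags± ; vertsDist = proj₁ distinct± ; inNext = proj₁ cyclic± } ,
    record { flags = proj₂ flags± ; vertsDist = proj₂ distinct± ; inNext = proj₂ cyclic± }
    where
    flags± : All (Flag E') (x ∷ xs) × All (Flag E') (y ∷ ys)
    flags± = All.++⁻ (x ∷ xs) (flags w)
    distinct± : Unique (map proj₂ (x ∷ xs)) × Unique (map proj₂ (y ∷ ys))
    distinct± = AllPairs-++⁻ (map proj₂ (x ∷ xs)) (subst Unique (map-++ proj₂ (x ∷ xs) (y ∷ ys)) (vertsDist w))
    cyclic± : Cyclic Meets (x ∷ xs) × Cyclic Meets (y ∷ ys)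
    cyclic± = Cyclic-split (λ {z} → subst (proj₂ z ∈_) (sym x≡y)) (λ {z} → subst (proj₂ z ∈_) x≡y) xs ys (inNext w)

  ClosedBergeWalk-cut : ∀ pre {x} mid {y} post → proj₁ x ≡ proj₁ y → ClosedBergeWalk E' (pre ++ x ∷ mid ++ y ∷ post) →
                        ClosedBergeWalk E' (x ∷ mid) × ClosedBergeWalk E' (y ∷ post ++ pre)
  ClosedBergeWalk-cut pre {x} mid {y} post x≡y w =
    ClosedBergeWalk-split x≡y mid (post ++ pre)
      (subst (ClosedBergeWalk E') (cong (x ∷_) (++-assoc mid (y ∷ post) pre)) (ClosedBergeWalk-rotate pre _ w))

  ClosedBergeWalk⇒BergeCycle : ∀ p q qs → ClosedBergeWalk E' (p ∷ q ∷ qs) → Unique (map proj₁ (p ∷ q ∷ qs)) → BergeCycle E'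
  ClosedBergeWalk⇒BergeCycle p q qs w edgesDist = record
    { first     = p
    ; others    = q ∷ qs
    ; twoOrMore = s≤s (s≤s z≤n)
    ; edgesIn   = All.map proj₁ (flags w)
    ; edgesDist = edgesDist
    ; vertsDist = vertsDist w
    ; inOwn     = All.map proj₂ (flags w)
    ; inNext    = inNext w
    }

  ClosedBergeWalk-noRepeat : BergeAcyclic E' → ∀ ps → ClosedBergeWalk E' ps → Unique (map proj₁ ps) → SingleHyperedge ps
  ClosedBergeWalk-noRepeat acyclic []           _ _ ()
  ClosedBergeWalk-noRepeat acyclic (p ∷ [])     _ _ (here refl) (here refl) = refl
  ClosedBergeWalk-noRepeat acyclic (p ∷ q ∷ qs) w u _ _ = ⊥-elim (acyclic (ClosedBergeWalk⇒BergeCycle p q qs w u))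

  ClosedBergeWalk⇒SingleHyperedge : BergeAcyclic E' → ∀ {ps} → ClosedBergeWalk E' ps → SingleHyperedge ps
  ClosedBergeWalk⇒SingleHyperedge acyclic w = go w (<-wellFounded _)
    where
    go : ∀ {ps} → ClosedBergeWalk E' ps → Acc _<_ (length ps) → SingleHyperedge ps
    go {ps} w _ with unique⊎hasRepeat proj₁ (≡-dec Bool._≟_) ps
    go w _             | inj₁ u = ClosedBergeWalk-noRepeat acyclic _ w u
    go w (acc shorter) | inj₂ (repeat pre x mid y post x≡y) =
      SingleHyperedge-resp-↭ cut (SingleHyperedge-++ x≡y (go wˣ (shorter |wˣ|<)) (go wʸ (shorter |wʸ|<)))
      where
      cut : pre ++ x ∷ mid ++ y ∷ post ↭ x ∷ mid ++ y ∷ post ++ pre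
      cut = ↭-cut pre x mid y post
      wˣ : ClosedBergeWalk E' (x ∷ mid)
      wˣ = proj₁ (ClosedBergeWalk-cut pre mid post x≡y w)
      wʸ : ClosedBergeWalk E' (y ∷ post ++ pre)
      wʸ = proj₂ (ClosedBergeWalk-cut pre mid post x≡y w)
      |cut| : length (x ∷ mid ++ y ∷ post ++ pre) ≤ length (pre ++ x ∷ mid ++ y ∷ post)
      |cut| = ≤-reflexive (sym (↭-length cut))
      |wˣ|< : length (x ∷ mid) < length (pre ++ x ∷ mid ++ y ∷ post)
      |wˣ|< = <-≤-trans (length-<-++ (x ∷ mid) y (post ++ pre)) |cut|
      |wʸ|< : length (y ∷ post ++ pre) < length (pre ++ x ∷ mid ++ y ∷ post)
      |wʸ|< = <-≤-trans (s≤s (length-++-≤ʳ (y ∷ post ++ pre) {mid})) |cut|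

module _ {n : ℕ} {E' : List (Subset n)} where

  BergeAcyclic-sharedPair⇒≡ : BergeAcyclic E' → ∀ {e f u v} → e ∈ₗ E' → f ∈ₗ E' → u ≢ v →
                              u ∈ e → v ∈ e → u ∈ f → v ∈ f → e ≡ f
  BergeAcyclic-sharedPair⇒≡ acyclic {e} {f} {u} {v} e∈ f∈ u≢v u∈e v∈e u∈f v∈f =
    ClosedBergeWalk⇒SingleHyperedge acyclic walk (here refl) (there (here refl))
    where
    walk : ClosedBergeWalk E' ((e , u) ∷ (f , v) ∷ [])
    walk = record
      { flags     = (e∈ , u∈e) ∷ (f∈ , v∈f) ∷ []
      ; vertsDist = (u≢v ∷ []) ∷ [] ∷ []
      ; inNext    = u∈f , v∈e , tt
      }

  Joined : Fin n → Fin n → Set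
  Joined u v = ∃[ e ] (e ∈ₗ E' × u ∈ e × v ∈ e)

  -- Meets (e , a) p does not depend on e.
  labelPath : ∀ {a} xs → Chain Joined (a ∷ xs) →
              ∃[ ps ] (map proj₂ ps ≡ xs × All (Flag E') ps × (∀ e → Chain Meets ((e , a) ∷ ps)))
  labelPath []       _                          = [] , refl , [] , λ _ → tt
  labelPath (b ∷ xs) ((e , e∈ , a∈e , b∈e) , c) with labelPath xs c
  ... | ps , refl , flags , linked = (e , b) ∷ ps , refl , (e∈ , b∈e) ∷ flags , λ _ → a∈e , linked e

  cycle⇒ClosedBergeWalk : ∀ s r → Unique (s ∷ r) → Chain Joined (close s r) →
                          ∃[ ps ] (map proj₂ ps ≡ s ∷ r × ClosedBergeWalk E' ps)
  cycle⇒ClosedBergeWalk s r distinct c with labelPath (r ++ [ s ]) c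
  ... | ps , ps≡ , flags , linked with initLast ps
  ...   | [] = contradiction (++-conicalʳ r [ s ] (sym ps≡)) λ ()
  ...   | qs ∷ʳ′ l with ∷ʳ-injective (map proj₂ qs) r (trans (sym (map-++ proj₂ qs [ l ])) ps≡)
  ...     | refl , refl = l ∷ qs , refl , record
    { flags     = All-resp-↭ (++-comm qs [ l ]) flags
    ; vertsDist = distinct
    ; inNext    = linked (proj₁ l)
    }

  closedChain-inHyperedge : BergeAcyclic E' → ∀ s r → Unique (s ∷ r) → Chain Joined (close s r) →
                      ∃[ e ] (e ∈ₗ E' × All (_∈ e) (s ∷ r))
  closedChain-inHyperedge acyclic s r distinct c with cycle⇒ClosedBergeWalk s r distinct c
  ... | p ∷ ps , ps≡ , walk = proj₁ p , proj₁ (All.head flags) , subst (All (_∈ proj₁ p)) ps≡ (All.map⁺ inP)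
    where
    open ClosedBergeWalk walk
    inP : All (λ q → proj₂ q ∈ proj₁ p) (p ∷ ps)
    inP = All.tabulate λ {q} q∈ →
      subst (proj₂ q ∈_) (ClosedBergeWalk⇒SingleHyperedge acyclic walk q∈ (here refl)) (proj₂ (All.lookup flags q∈))

triangle-corners : ∀ {n} {G : SimpleGraph n} {e} → IsTriangle G e →
                   ∃[ ws ] (length ws ≡ 3 × (∀ {z} → z ∈ e → z ∈ₗ ws))
triangle-corners (a , b , c , _ , _ , _ , refl) = a ∷ b ∷ c ∷ [] , refl , corner
  where
  corner : ∀ {z} → z ∈ ⁅ a ⁆ ∪ ⁅ b ⁆ ∪ ⁅ c ⁆ → z ∈ₗ a ∷ b ∷ c ∷ []
  corner z∈ with x∈p∪q⁻ ⁅ a ⁆ (⁅ b ⁆ ∪ ⁅ c ⁆) z∈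
  ... | inj₁ z∈a = here (x∈⁅y⁆⇒x≡y a z∈a)
  ... | inj₂ z∈bc with x∈p∪q⁻ ⁅ b ⁆ ⁅ c ⁆ z∈bc
  ...   | inj₁ z∈b = there (here (x∈⁅y⁆⇒x≡y b z∈b))
  ...   | inj₂ z∈c = there (there (here (x∈⁅y⁆⇒x≡y c z∈c)))

inducedBy-sym : ∀ {n} {E' : List (Subset n)} {u v} → E (inducedBy E') u v → E (inducedBy E') v u
inducedBy-sym (u≢v , e , e∈ , u∈e , v∈e) = (λ v≡u → u≢v (sym v≡u)) , e , e∈ , v∈e , u∈e

module _ {n : ℕ} {G : SimpleGraph n} {V' : Subset n} {E' : List (Subset n)}
         (hyp : IsSubHypergraphOfH G V' E') (acyclic : BergeAcyclic E')
         {H : SubGraph n} (H⊆G[E'] : ∀ {u v} → E H u v → E (inducedBy E') u v) where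

  cycle-inHyperedge : (C : Cycle H) → ∃[ e ] (e ∈ₗ E' × All (_∈ e) (vertices C))
  cycle-inHyperedge C = closedChain-inHyperedge acyclic (start C) (rest C) (distinct C)
                          (Chain-map (λ uv → proj₂ (H⊆G[E'] uv)) (close (start C) (rest C)) (adjacent C))

  corners : ∀ {e} → e ∈ₗ E' → ∃[ ws ] (length ws ≡ 3 × (∀ {z} → z ∈ e → z ∈ₗ ws))
  corners e∈ = triangle-corners {G = G} (proj₁ (All.lookup hyp e∈))

  cycle-inCorners : ∀ {e} (C : Cycle H) (e∈ : e ∈ₗ E') → All (_∈ e) (vertices C) → vertices C ⊆ proj₁ (corners e∈)
  cycle-inCorners C e∈ C⊆e v∈C = proj₂ (proj₂ (corners e∈)) (All.lookup C⊆e v∈C)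

  allCyclesTriangles : AllCyclesTriangles H
  allCyclesTriangles C with cycle-inHyperedge C
  ... | e , e∈ , C⊆e = cycleLength≡3 (proj₁ (proj₂ (corners e∈))) C (cycle-inCorners C e∈ C⊆e)

  EdgeOf-inHyperedge : ∀ {e u v} (C : Cycle H) → All (_∈ e) (vertices C) → EdgeOf C u v → u ∈ e × v ∈ e
  EdgeOf-inHyperedge C C⊆e uv∈C with Equivalence.to (EdgeOf⇔-triangle C (allCyclesTriangles C)) uv∈C
  ... | u∈C , v∈C , _ = All.lookup C⊆e u∈C , All.lookup C⊆e v∈C

  edgeInOneCycle : ∀ u v → E H u v → (C D : Cycle H) → EdgeOf C u v → EdgeOf D u v → SameCycle C D
  edgeInOneCycle u v uv C D uv∈C uv∈D with cycle-inHyperedge C | cycle-inHyperedge D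
  ... | e , e∈ , C⊆e | f , f∈ , D⊆f
    with EdgeOf-inHyperedge C C⊆e uv∈C | EdgeOf-inHyperedge D D⊆f uv∈D
  ... | u∈e , v∈e | u∈f , v∈f with BergeAcyclic-sharedPair⇒≡ acyclic e∈ f∈ (proj₁ (H⊆G[E'] uv)) u∈e v∈e u∈f v∈f
  ... | refl = SameCycle-⊆ (proj₁ (proj₂ (corners e∈))) C D (cycle-inCorners C e∈ C⊆e) (cycle-inCorners D e∈ D⊆f)

mainTheorem7 : ∀ {n : ℕ} (G : SimpleGraph n) → Chordal G
    → (V' : Subset n) (E' : List (Subset n))
    → IsSubHypergraphOfH G V' E' → BergeAcyclic E'
    → (x : Fin n) → V (inducedBy E') x
    → IsCactus (componentOf (inducedBy E') x)
      × AllCyclesTriangles (componentOf (inducedBy E') x)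
mainTheorem7 G _ V' E' hyp acyclic x x∈ =
  (componentOf-connected (inducedBy E') x∈ inducedBy-sym , edgeInOneCycle {G = G} {V'} hyp acyclic component⊆) ,
  allCyclesTriangles {G = G} {V'} hyp acyclic component⊆
  where
  component⊆ : ∀ {u v} → E (componentOf (inducedBy E') x) u v → E (inducedBy E') u v
  component⊆ (_ , _ , uv) = uv
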